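{- For any graph $G$ of order $n$ with minimum degree $\delta(G)$ and packing number $\rho(G)$, $\gamma_{qtR}(G)\le n-\rho(G)(\delta(G)-2)$.
   Context: All graphs are finite, simple and undirected. A set $B\subseteq V(G)$ is a packing if $N[u]\cap N[v]=\emptyset$ for all distinct $u,v\in B$ (closed neighborhoods); $\rho(G)$ is the maximum size of a packing. For $f:V(G)\to\{0,1,2\}$ write $V_i=\{v:f(v)=i\}$, weight $\sum_v f(v)$. A quasi-total Roman dominating function (QTRDF) is a function $f:V(G)\to\{0,1,2\}$ such that every vertex $u$ with $f(u)=0$ is adjacent to some $v$ with $f(v)=2$, and every vertex $x$ that is isolated in the subgraph induced by $V_1\cup V_2$ satisfies $f(x)=1$. $\gamma_{qtR}(G)$ is the minimum weight of a QTRDF on $G$. -}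

module Defs where

open import Data.Nat using (ℕ; zero; suc; _+_; _≤_)
open import Data.Fin using (Fin)
open import Data.Fin.Subset using (Subset; _∈_; ∣_∣)
open import Data.Bool using (Bool; true; false)
open import Data.List using (List; map; length; filter)
open import Data.Nat.ListAction using (sum)
open import Data.List.Base using (allFin)
open import Data.Product using (Σ; ∃; _×_; _,_)
open import Data.Sum using (_⊎_)
open import Data.Empty using (⊥)
open import Relation.Nullary using (¬_)
open import Relation.Binary.PropositionalEquality using (_≡_; _≢_)
open import Data.Bool.Properties using (T?)
open import Data.Bool using (T)

record Graph (n : ℕ) : Set where
  field
    adj   : Fin n → Fin n → Bool
    sym   : ∀ u v → adj u v ≡ adj v u
    irrefl : ∀ v → adj v v ≡ false

open Graph public

Adj : ∀ {n} → Graph n → Fin n → Fin n → Set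
Adj G u v = T (adj G u v)

deg : ∀ {n} → Graph n → Fin n → ℕ
deg {n} G v = length (filter (λ u → T? (adj G v u)) (allFin n))

IsMinDegree : ∀ {n} → Graph n → ℕ → Set
IsMinDegree {n} G d = (∃ λ v → deg G v ≡ d) × (∀ v → d ≤ deg G v)

InClosedNbhd : ∀ {n} → Graph n → Fin n → Fin n → Set
InClosedNbhd G u w = (w ≡ u) ⊎ Adj G u w

IsPacking : ∀ {n} → Graph n → Subset n → Set
IsPacking {n} G B = ∀ u v → u ∈ B → v ∈ B → u ≢ v →
  ¬ (∃ λ w → InClosedNbhd G u w × InClosedNbhd G v w)

IsPackingNumber : ∀ {n} → Graph n → ℕ → Set
IsPackingNumber G p =
  (∃ λ B → IsPacking G B × ∣ B ∣ ≡ p) × (∀ B → IsPacking G B → ∣ B ∣ ≤ p)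

data Label : Set where
  l0 l1 l2 : Label

val : Label → ℕ
val l0 = 0
val l1 = 1
val l2 = 2

weight : ∀ {n} → (Fin n → Label) → ℕ
weight {n} f = sum (map (λ v → val (f v)) (allFin n))

InV12 : ∀ {n} → (Fin n → Label) → Fin n → Set
InV12 f x = f x ≢ l0

IsolatedInV12 : ∀ {n} → Graph n → (Fin n → Label) → Fin n → Set
IsolatedInV12 G f x = InV12 f x × (∀ y → Adj G x y → ¬ InV12 f y)

IsQTRDF : ∀ {n} → Graph n → (Fin n → Label) → Set
IsQTRDF G f =
  (∀ u → f u ≡ l0 → ∃ λ v → Adj G u v × f v ≡ l2) ×
  (∀ x → IsolatedInV12 G f x → f x ≡ l1)

IsQTRNumber : ∀ {n} → Graph n → ℕ → Set
IsQTRNumber G g =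
  (∃ λ f → IsQTRDF G f × weight f ≡ g) × (∀ f → IsQTRDF G f → g ≤ weight f)

-- Fix a maximum packing B and, when δ ≥ 1, a neighbour c v of every vertex v.
-- Label the vertices of B with 2, every other vertex adjacent to some v ∈ B
-- other than c v with 0, and the rest with 1; disjointness of the closed
-- neighbourhoods of B makes this a QTRDF. Charging each vertex w the number of
-- packing vertices adjacent to it, a local check gives
--   f w + #{v ∈ B : v ~ w} ≤ 1 + [w ∈ B] + #{v ∈ B : c v = w},
-- and summing over w yields weight f + ρδ ≤ weight f + Σ_{v ∈ B} deg v ≤ n + 2ρ.
-- For δ = 0 the constant labelling 1 suffices.
module Submission where

open import Defs hiding (sym)
open import Data.Bool using (Bool; true; false; T)
open import Data.Bool.Properties using (T?)
open import Data.Empty using (⊥-elim)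
open import Data.Fin using (Fin; zero; suc)
open import Data.Fin.Properties using (_≟_; any?; suc-injective; 0≢1+n)
open import Data.Fin.Subset using (Subset; _∈_; ∣_∣; inside; outside)
open import Data.Fin.Subset.Properties using (_∈?_)
open import Data.List using (map; length; filter; tabulate)
open import Data.Nat using (ℕ; zero; suc; _+_; _*_; _∸_; _≤_; _<_; z≤n; s≤s)
open import Data.Nat.ListAction using (sum)
open import Data.Nat.Properties
  using ( +-*-semiring; +-identityʳ; *-zeroʳ; ≤-refl; ≤-reflexive; ≤-trans
        ; +-mono-≤; +-monoˡ-≤; +-monoʳ-≤; m≤m+n; m≤n+m; m+n≤o⇒n≤o; m+n≤o⇒m≤o∸n
        ; module ≤-Reasoning )
open import Algebra.Properties.Semiring.Sum +-*-semiring
  using (sum-syntax; ∑-distrib-+; ∑-comm; *-distribʳ-sum)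
open import Data.Product using (∃; _×_; _,_; proj₁; proj₂)
import Data.Product as Product
open import Data.Sum using (inj₁; inj₂)
open import Data.Vec using ([]; _∷_)
open import Function using (_∘_; id; const)
open import Relation.Nullary using (¬_; Dec; does; yes; no; _because_; ¬?; _×-dec_; contradiction)
open import Relation.Nullary.Decidable using (decidable-stable; dec-true)
open import Relation.Unary using (Pred; Decidable)
open import Relation.Binary.PropositionalEquality

𝟙 : Bool → ℕ
𝟙 true  = 1
𝟙 false = 0

count : ∀ {n p} {P : Pred (Fin n) p} → Decidable P → ℕ
count {n} P? = ∑[ i < n ] 𝟙 (does (P? i))

∑-mono-≤ : ∀ {n} {f g : Fin n → ℕ} → (∀ i → f i ≤ g i) → ∑[ i < n ] f i ≤ ∑[ i < n ] g i
∑-mono-≤ {zero}  _   = z≤n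
∑-mono-≤ {suc n} f≤g = +-mono-≤ (f≤g zero) (∑-mono-≤ (f≤g ∘ suc))

∑-one : ∀ n → ∑[ i < n ] 1 ≡ n
∑-one zero    = refl
∑-one (suc n) = cong suc (∑-one n)

𝟙-mono : ∀ {a b} {A : Set a} {B : Set b} (a? : Dec A) (b? : Dec B) → (A → B) → 𝟙 (does a?) ≤ 𝟙 (does b?)
𝟙-mono (false because _) _                _   = z≤n
𝟙-mono (true because _)  (true because _) _   = ≤-refl
𝟙-mono (yes a)           (no ¬b)          A⇒B = contradiction (A⇒B a) ¬b

𝟙-*-≤ : ∀ {a} {A : Set a} {m k} (a? : Dec A) → (A → m ≤ k) → 𝟙 (does a?) * m ≤ k
𝟙-*-≤ {m = m} (yes a) m≤k = subst (_≤ _) (sym (+-identityʳ m)) (m≤k a)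
𝟙-*-≤         (no _)  _   = z≤n

count-mono : ∀ {n p q} {P : Pred (Fin n) p} {Q : Pred (Fin n) q} (P? : Decidable P) (Q? : Decidable Q) →
             (∀ i → P i → Q i) → count P? ≤ count Q?
count-mono P? Q? P⇒Q = ∑-mono-≤ λ i → 𝟙-mono (P? i) (Q? i) (P⇒Q i)

count-none : ∀ {n p} {P : Pred (Fin n) p} (P? : Decidable P) → (∀ i → ¬ P i) → count P? ≡ 0
count-none {zero}  P? ¬P = refl
count-none {suc n} P? ¬P with P? zero
... | yes P0 = contradiction P0 (¬P zero)
... | no _   = count-none (P? ∘ suc) (¬P ∘ suc)

count-atMostOne : ∀ {n p} {P : Pred (Fin n) p} (P? : Decidable P) →
                  (∀ {i j} → P i → P j → i ≡ j) → count P? ≤ 1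
count-atMostOne {zero}  P? unique = z≤n
count-atMostOne {suc n} P? unique with P? zero
... | yes P0 = ≤-reflexive (cong suc (count-none (P? ∘ suc) λ i Pi → 0≢1+n (unique P0 Pi)))
... | no _   = count-atMostOne (P? ∘ suc) λ Pi Pj → suc-injective (unique Pi Pj)

count>0⇒∃ : ∀ {n p} {P : Pred (Fin n) p} (P? : Decidable P) → 0 < count P? → ∃ P
count>0⇒∃ {suc n} P? pos with P? zero
... | yes P0 = zero , P0
... | no _   = Product.map suc id (count>0⇒∃ (P? ∘ suc) pos)

∣p∣≡count : ∀ {n} (p : Subset n) → ∣ p ∣ ≡ count (_∈? p)
∣p∣≡count []            = refl
∣p∣≡count (inside  ∷ p) = cong suc (∣p∣≡count p)
∣p∣≡count (outside ∷ p) = ∣p∣≡count p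

sum-map-tabulate : ∀ {a} {A : Set a} {n} (g : Fin n → A) (h : A → ℕ) →
                   sum (map h (tabulate g)) ≡ ∑[ i < n ] h (g i)
sum-map-tabulate {n = zero}  g h = refl
sum-map-tabulate {n = suc n} g h = cong (h (g zero) +_) (sum-map-tabulate (g ∘ suc) h)

length-filter-tabulate : ∀ {a p} {A : Set a} {P : Pred A p} (P? : Decidable P) {n} (g : Fin n → A) →
                         length (filter P? (tabulate g)) ≡ ∑[ i < n ] 𝟙 (does (P? (g i)))
length-filter-tabulate P? {zero}  g = refl
length-filter-tabulate P? {suc n} g with does (P? (g zero))
... | true  = cong suc (length-filter-tabulate P? (g ∘ suc))
... | false = length-filter-tabulate P? (g ∘ suc)

weight≡∑ : ∀ {n} (f : Fin n → Label) → weight f ≡ ∑[ v < n ] val (f v)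
weight≡∑ f = sum-map-tabulate id (val ∘ f)

module _ {n} (G : Graph n) where

  Adj? : ∀ u → Decidable (Adj G u)
  Adj? u v = T? (adj G u v)

  Adj-sym : ∀ {u v} → Adj G u v → Adj G v u
  Adj-sym {u} {v} = subst T (Graph.sym G u v)

  Adj-irrefl : ∀ {v} → ¬ Adj G v v
  Adj-irrefl {v} = subst T (Graph.irrefl G v)

  deg≡count : ∀ v → deg G v ≡ count (Adj? v)
  deg≡count v = length-filter-tabulate (Adj? v) id

  neighbour : ∀ {v} → 0 < deg G v → ∃ (Adj G v)
  neighbour {v} pos = count>0⇒∃ (Adj? v) (subst (0 <_) (deg≡count v) pos)

  module _ {B : Subset n} (B-packing : IsPacking G B) {u v : Fin n} (u∈B : u ∈ B) (v∈B : v ∈ B) where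

    packing-closedNbhd-unique : ∀ {w} → InClosedNbhd G u w → InClosedNbhd G v w → u ≡ v
    packing-closedNbhd-unique {w} w∈N[u] w∈N[v] with u ≟ v
    ... | yes u≡v = u≡v
    ... | no  u≢v = ⊥-elim (B-packing u v u∈B v∈B u≢v (w , w∈N[u] , w∈N[v]))

    packing-nbr-unique : ∀ {w} → Adj G u w → Adj G v w → u ≡ v
    packing-nbr-unique u~w v~w = packing-closedNbhd-unique (inj₂ u~w) (inj₂ v~w)

    packing-independent : ¬ Adj G u v
    packing-independent u~v with packing-closedNbhd-unique (inj₂ u~v) (inj₁ refl)
    ... | refl = Adj-irrefl u~v

module PackingLabelling {n} (G : Graph n) {B : Subset n} (B-packing : IsPacking G B)
                        (c : Fin n → Fin n) (c-adj : ∀ v → Adj G v (c v)) where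

  Shadowed : Fin n → Set
  Shadowed x = ∃ λ v → v ∈ B × Adj G v x × c v ≢ x

  shadowed? : Decidable Shadowed
  shadowed? x = any? λ v → v ∈? B ×-dec Adj? G v x ×-dec ¬? (c v ≟ x)

  label : ∀ {P Q : Set} → Dec P → Dec Q → Label
  label (true  because _) _                 = l2
  label (false because _) (true  because _) = l0
  label (false because _) (false because _) = l1

  f : Fin n → Label
  f x = label (x ∈? B) (shadowed? x)

  ∈⇒f≡l2 : ∀ {x} → x ∈ B → f x ≡ l2
  ∈⇒f≡l2 {x} x∈B with x ∈? B
  ... | yes _   = refl
  ... | no  x∉B = contradiction x∈B x∉B

  f≡l2⇒∈ : ∀ {x} → f x ≡ l2 → x ∈ B
  f≡l2⇒∈ {x} _ with x ∈? B | shadowed? x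
  f≡l2⇒∈ {x} _  | yes x∈B | _             = x∈B
  f≡l2⇒∈ {x} () | no _    | true because _
  f≡l2⇒∈ {x} () | no _    | false because _

  f≡l0⇒shadowed : ∀ {x} → f x ≡ l0 → Shadowed x
  f≡l0⇒shadowed {x} _ with x ∈? B | shadowed? x
  f≡l0⇒shadowed {x} () | true because _ | _
  f≡l0⇒shadowed {x} _  | no _           | yes s = s
  f≡l0⇒shadowed {x} () | no _           | no _

  f≡l1⇒¬shadowed : ∀ {x} → f x ≡ l1 → ¬ Shadowed x
  f≡l1⇒¬shadowed {x} _ with x ∈? B | shadowed? x
  f≡l1⇒¬shadowed {x} () | true because _ | _
  f≡l1⇒¬shadowed {x} () | no _           | yes _
  f≡l1⇒¬shadowed {x} _  | no _           | no ¬s = ¬s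

  chosen-¬shadowed : ∀ {x} → x ∈ B → ¬ Shadowed (c x)
  chosen-¬shadowed x∈B (v , v∈B , v~cx , cv≢cx)
    with packing-nbr-unique G B-packing x∈B v∈B (c-adj _) v~cx
  ... | refl = cv≢cx refl

  f-qtrdf : IsQTRDF G f
  f-qtrdf = dominated , isolated⇒l1
    where
    dominated : ∀ u → f u ≡ l0 → ∃ λ v → Adj G u v × f v ≡ l2
    dominated u fu≡l0 with f≡l0⇒shadowed fu≡l0
    ... | v , v∈B , v~u , _ = v , Adj-sym G v~u , ∈⇒f≡l2 v∈B

    isolated⇒l1 : ∀ x → IsolatedInV12 G f x → f x ≡ l1
    isolated⇒l1 x (fx≢l0 , isolated) with f x in fx≡
    ... | l0 = contradiction refl fx≢l0
    ... | l1 = refl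
    ... | l2 = ⊥-elim (isolated (c x) (c-adj x) λ fcx≡l0 →
                 chosen-¬shadowed (f≡l2⇒∈ fx≡) (f≡l0⇒shadowed fcx≡l0))

  Dominates : Fin n → Fin n → Set
  Dominates w v = v ∈ B × Adj G v w

  Chooses : Fin n → Fin n → Set
  Chooses w v = v ∈ B × c v ≡ w

  dominates? : ∀ w → Decidable (Dominates w)
  dominates? w v = v ∈? B ×-dec Adj? G v w

  chooses? : ∀ w → Decidable (Chooses w)
  chooses? w v = v ∈? B ×-dec c v ≟ w

  dominators : Fin n → ℕ
  dominators w = count (dominates? w)

  choosers : Fin n → ℕ
  choosers w = count (chooses? w)

  local-bound : ∀ w → val (f w) + dominators w ≤ suc (𝟙 (does (w ∈? B)) + choosers w)
  local-bound w with f w in fw≡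
  ... | l0 = ≤-trans (count-atMostOne (dominates? w) λ (u∈B , u~w) (v∈B , v~w) →
                       packing-nbr-unique G B-packing u∈B v∈B u~w v~w)
                     (s≤s z≤n)
  ... | l1 = s≤s (≤-trans (count-mono (dominates? w) (chooses? w) λ v (v∈B , v~w) → v∈B , cv≡w v∈B v~w)
                          (m≤n+m _ _))
    where
    cv≡w : ∀ {v} → v ∈ B → Adj G v w → c v ≡ w
    cv≡w {v} v∈B v~w = decidable-stable (c v ≟ w) λ cv≢w → f≡l1⇒¬shadowed fw≡ (v , v∈B , v~w , cv≢w)
  ... | l2 = begin
    2 + dominators w                      ≡⟨ cong (2 +_) no-dominators ⟩
    2                                     ≡⟨ cong (suc ∘ 𝟙) (dec-true (w ∈? B) w∈B) ⟨
    suc (𝟙 (does (w ∈? B)))               ≤⟨ s≤s (m≤m+n _ _) ⟩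
    suc (𝟙 (does (w ∈? B)) + choosers w)  ∎
    where
    open ≤-Reasoning
    w∈B = f≡l2⇒∈ fw≡
    no-dominators : dominators w ≡ 0
    no-dominators = count-none (dominates? w) λ v (v∈B , v~w) → packing-independent G B-packing v∈B w∈B v~w

  module _ {δ : ℕ} (δ-min : ∀ v → δ ≤ deg G v) where

    dominators-total : ∣ B ∣ * δ ≤ ∑[ w < n ] dominators w
    dominators-total = begin
      ∣ B ∣ * δ                                          ≡⟨ cong (_* δ) (∣p∣≡count B) ⟩
      count (_∈? B) * δ                                  ≡⟨ *-distribʳ-sum δ (λ v → 𝟙 (does (v ∈? B))) ⟩
      ∑[ v < n ] (𝟙 (does (v ∈? B)) * δ)                 ≤⟨ ∑-mono-≤ degree-if-in-B ⟩
      ∑[ v < n ] ∑[ w < n ] 𝟙 (does (dominates? w v))   ≡⟨ ∑-comm (λ v w → 𝟙 (does (dominates? w v))) ⟩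
      ∑[ w < n ] dominators w                            ∎
      where
      open ≤-Reasoning
      degree-if-in-B : ∀ v → 𝟙 (does (v ∈? B)) * δ ≤ ∑[ w < n ] 𝟙 (does (dominates? w v))
      degree-if-in-B v = 𝟙-*-≤ (v ∈? B) λ v∈B → begin
        δ                                      ≤⟨ δ-min v ⟩
        deg G v                                ≡⟨ deg≡count G v ⟩
        count (Adj? G v)                       ≤⟨ count-mono (Adj? G v) (λ w → dominates? w v) (λ w v~w → v∈B , v~w) ⟩
        ∑[ w < n ] 𝟙 (does (dominates? w v))   ∎

  choosers-total : ∑[ w < n ] choosers w ≤ ∣ B ∣
  choosers-total = begin
    ∑[ w < n ] choosers w                          ≡⟨ ∑-comm (λ w v → 𝟙 (does (chooses? w v))) ⟩
    ∑[ v < n ] ∑[ w < n ] 𝟙 (does (chooses? w v))  ≤⟨ ∑-mono-≤ chosen-once ⟩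
    count (_∈? B)                                  ≡⟨ ∣p∣≡count B ⟨
    ∣ B ∣                                          ∎
    where
    open ≤-Reasoning
    chosen-once : ∀ v → ∑[ w < n ] 𝟙 (does (chooses? w v)) ≤ 𝟙 (does (v ∈? B))
    chosen-once v with v ∈? B
    ... | yes v∈B = count-atMostOne (λ w → yes v∈B ×-dec c v ≟ w) λ (_ , cv≡w) (_ , cv≡w′) →
                      trans (sym cv≡w) cv≡w′
    ... | no  v∉B = ≤-reflexive (count-none (λ w → no v∉B ×-dec c v ≟ w) λ w (v∈B , _) → v∉B v∈B)

  weight-bound : ∀ {δ} → (∀ v → δ ≤ deg G v) → weight f + ∣ B ∣ * δ ≤ n + 2 * ∣ B ∣
  weight-bound {δ} δ-min = begin
    weight f + ∣ B ∣ * δ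
      ≤⟨ +-mono-≤ (≤-reflexive (weight≡∑ f)) (dominators-total δ-min) ⟩
    ∑[ w < n ] val (f w) + ∑[ w < n ] dominators w
      ≡⟨ ∑-distrib-+ (val ∘ f) dominators ⟨
    ∑[ w < n ] (val (f w) + dominators w)
      ≤⟨ ∑-mono-≤ local-bound ⟩
    ∑[ w < n ] (1 + (𝟙 (does (w ∈? B)) + choosers w))
      ≡⟨ ∑-distrib-+ (const 1) (λ w → 𝟙 (does (w ∈? B)) + choosers w) ⟩
    ∑[ w < n ] 1 + ∑[ w < n ] (𝟙 (does (w ∈? B)) + choosers w)
      ≡⟨ cong₂ _+_ (∑-one n) (∑-distrib-+ (λ w → 𝟙 (does (w ∈? B))) choosers) ⟩
    n + (count (_∈? B) + ∑[ w < n ] choosers w)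
      ≤⟨ +-monoʳ-≤ n (+-mono-≤ (≤-reflexive (sym (∣p∣≡count B))) choosers-total) ⟩
    n + (∣ B ∣ + ∣ B ∣)
      ≡⟨ cong (λ k → n + (∣ B ∣ + k)) (+-identityʳ ∣ B ∣) ⟨
    n + 2 * ∣ B ∣
      ∎
    where open ≤-Reasoning

packing⇒light-qtrdf : ∀ {n} (G : Graph n) {B δ} → IsPacking G B → (∀ v → δ ≤ deg G v) →
                      ∃ λ f → IsQTRDF G f × weight f + ∣ B ∣ * δ ≤ n + 2 * ∣ B ∣
packing⇒light-qtrdf {n} G {B} {zero} _ _ = const l1 , ((λ _ ()) , λ _ _ → refl) , all-ones-bound
  where
  all-ones-bound : weight {n} (const l1) + ∣ B ∣ * 0 ≤ n + 2 * ∣ B ∣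
  all-ones-bound rewrite weight≡∑ {n} (const l1) | ∑-one n | *-zeroʳ ∣ B ∣ | +-identityʳ n = m≤m+n n _
packing⇒light-qtrdf G {δ = suc δ} B-packing δ-min = f , f-qtrdf , weight-bound δ-min
  where
  c-neighbour : ∀ v → ∃ (Adj G v)
  c-neighbour v = neighbour G (≤-trans (s≤s z≤n) (δ-min v))
  open PackingLabelling G B-packing (proj₁ ∘ c-neighbour) (proj₂ ∘ c-neighbour)

open import Data.Integer as ℤ using (ℤ; +_; _-_; +≤+)
import Data.Integer.Properties as ℤ
open import Data.Integer.Tactic.RingSolver using (solve-∀)

ℕ-bound⇒ℤ-bound : ∀ n ρ δ γ → γ + ρ * δ ≤ n + 2 * ρ → + γ ℤ.≤ + n - + ρ ℤ.* (+ δ - + 2)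
ℕ-bound⇒ℤ-bound n ρ δ γ bound = begin
  + γ                                     ≤⟨ +≤+ (m+n≤o⇒m≤o∸n γ bound) ⟩
  + (n + 2 * ρ ∸ ρ * δ)                   ≡⟨ ℤ.⊖-≥ (m+n≤o⇒n≤o γ bound) ⟨
  (n + 2 * ρ) ℤ.⊖ (ρ * δ)                 ≡⟨ ℤ.[+m]-[+n]≡m⊖n (n + 2 * ρ) (ρ * δ) ⟨
  + (n + 2 * ρ) - + (ρ * δ)               ≡⟨ cong₂ _-_ (ℤ.pos-+ n (2 * ρ)) (ℤ.pos-* ρ δ) ⟩
  + n ℤ.+ + (2 * ρ) - + ρ ℤ.* + δ         ≡⟨ cong (λ k → + n ℤ.+ k - + ρ ℤ.* + δ) (ℤ.pos-* 2 ρ) ⟩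
  + n ℤ.+ + 2 ℤ.* + ρ - + ρ ℤ.* + δ       ≡⟨ rearrange (+ n) (+ ρ) (+ δ) ⟩
  + n - + ρ ℤ.* (+ δ - + 2)               ∎
  where
  open ℤ.≤-Reasoning
  rearrange : ∀ (n ρ δ : ℤ) → n ℤ.+ + 2 ℤ.* ρ - ρ ℤ.* δ ≡ n - ρ ℤ.* (δ - + 2)
  rearrange = solve-∀

mainTheorem8 : ∀ (n : ℕ) (G : Graph n) (δ ρ γ : ℕ) →
    IsMinDegree G δ → IsPackingNumber G ρ → IsQTRNumber G γ →
    + γ ℤ.≤ + n - + ρ ℤ.* (+ δ - + 2)
mainTheorem8 n G δ _ γ (_ , δ-min) ((B , B-packing , refl) , _) (_ , γ-min) =
  let f , f-qtrdf , f-light = packing⇒light-qtrdf G B-packing δ-min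
  in  ℕ-bound⇒ℤ-bound n ∣ B ∣ δ γ (≤-trans (+-monoˡ-≤ (∣ B ∣ * δ) (γ-min f f-qtrdf)) f-light)
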